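{- Let $d\geq 2$, let $i,j\geq 0$ with $j\leq i-1$, $I=[i,i+d-2]$ and $J=[j,j+d-1]$. If $2\leq r\leq d-1$, then \[ b^I_{J\setminus\{j+r-1\}}=\pi^I_{J\setminus\{j+r-1\}}\; b_{i+d-j-r-1,\,d-r}. \] If $r=1$ or $r=d$, then \[ b^I_{J\setminus\{j\}}=\pi^I_{J\setminus\{j\}}\quad\text{and}\quad b^I_{J\setminus\{j+d-1\}}=\pi^I_{J\setminus\{j+d-1\}}. \]
   Context: For integers $p,q\geq 0$, $b_{p,q}=\binom{p}{q}$, with $b_{p,q}=0$ if $q>p$. For $k\leq l$, $[k,l]=\{k,\ldots,l\}$. For finite sets $I=\{i_1<\cdots<i_m\}$, $J=\{j_1<\cdots<j_m\}$ of non-negative integers, $b^I_J$ is the determinant of the $m\times m$ matrix with $(r,s)$ entry $b_{i_r,j_s}$, and $\pi^I_J=\frac{b_{i_1,j_1}\cdots b_{i_m,j_1}}{b_{j_1,j_1}\cdots b_{j_m,j_1}}$ (a rational number). -}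

module Defs where

open import Data.Nat as ℕ using (ℕ; zero; suc; _∸_)
open import Data.Nat.Combinatorics using (_C_)
open import Data.Integer as ℤ using (ℤ; +_)
open import Data.List using (List; []; _∷_; map; filter; upTo; foldr)
open import Relation.Nullary using (yes; no; ¬?)
open import Data.Rational as ℚ using (ℚ; 0ℚ; 1ℚ; ≢-nonZero)
import Data.Rational.Properties as ℚP

-- b_{p,q} = binomial(p,q) (library version; it is 0 when q > p)
b : ℕ → ℕ → ℕ
b p q = p C q

[_,_] : ℕ → ℕ → List ℕ
[ k , l ] = map (k ℕ.+_) (upTo (suc l ∸ k))

_∖[_] : List ℕ → ℕ → List ℕ
J ∖[ x ] = filter (λ y → ¬? (y ℕ.≟ x)) J

dropAt : {A : Set} → ℕ → List A → List A
dropAt k       []       = []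
dropAt zero    (a ∷ as) = as
dropAt (suc k) (a ∷ as) = a ∷ dropAt k as

-- determinant of a square matrix (list of rows), by Laplace expansion
-- along the first row; the fuel argument is the size of the matrix
sign : ℕ → ℤ
sign zero          = + 1
sign (suc zero)    = ℤ.- (+ 1)
sign (suc (suc k)) = sign k

detN : ℕ → List (List ℤ) → ℤ
detN zero    rows         = + 1
detN (suc n) []           = + 1
detN (suc n) (row ∷ rows) = go 0 row
  where
  go : ℕ → List ℤ → ℤ
  go k []       = + 0
  go k (a ∷ as) = sign k ℤ.* a ℤ.* detN n (map (dropAt k) rows) ℤ.+ go (suc k) as

det : List (List ℤ) → ℤ
det M = detN (Data.List.length M) M

bIJ : List ℕ → List ℕ → ℤ
bIJ I J = det (map (λ a → map (λ c → + b a c) J) I)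

-- division in ℚ, with the (never used here) convention p / 0 = 0
_÷₀_ : ℚ → ℚ → ℚ
p ÷₀ q with q ℚP.≟ 0ℚ
... | yes _  = 0ℚ
... | no q≢0 = ℚ._÷_ p q {{≢-nonZero q≢0}}

prodℚ : List ℚ → ℚ
prodℚ = foldr ℚ._*_ 1ℚ

toℚ : ℕ → ℚ
toℚ n = (+ n) ℚ./ 1

πIJ : List ℕ → List ℕ → ℚ
πIJ I []         = 1ℚ
πIJ I (j₁ ∷ J')  =
  prodℚ (map (λ a → toℚ (b a j₁)) I) ÷₀ prodℚ (map (λ c → toℚ (b c j₁)) (j₁ ∷ J'))

ℤtoℚ : ℤ → ℚ
ℤtoℚ z = z ℚ./ 1

{-# OPTIONS --safe #-}
module Submission where

-- For j ≤ c one has C(c,j)·C(a,c) = C(a,j)·C(a−j,c−j).  So, with j the least column index, multiplying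
-- column c of (b_{a,c}) by C(c,j) and pulling C(a,j) out of row a gives b^I_J = π^I_J · det(C(a−j,c−j)).
-- For the intervals of the theorem this is a gap determinant K(y,g,t) = det(C(a,c)) with rows
-- a = y, …, y+g+t−1 (y = i−j) and columns c = 0, …, g−1, g+1, …, g+t.  Shifting every row by one turns
-- the column C(·,c) into C(·,c) + C(·,c−1) (Pascal); subtracting left neighbours undoes this, except for
-- the first column after the gap, which splits the determinant into two.  So K(y+1,g,t+1) = K(y,g,t+1) +
-- K(y+1,g+1,t) and K(y+1,g,0) = K(y,g,0), while K(0,g,t) is triangular with value [t = 0]; therefore
-- K(y,g,t) = C(y+t−1,t).

open import Defs

module Determinants where

  open import Data.Integer using (ℤ; 0ℤ; 1ℤ; _+_; _*_; -_)
  open import Data.Integer.Properties using (*-zeroʳ; *-zeroˡ; +-identityʳ; *-identityˡ; *-comm)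
  open import Data.Integer.Tactic.RingSolver using (solve-∀)
  open import Data.List using (List; []; _∷_; _++_; map; length; foldr)
  import Data.List.Properties as List
  open import Data.List.Relation.Unary.All using (All; []; _∷_)
  open import Data.Nat using (ℕ; zero; suc)
  import Data.Nat.Properties as ℕ
  open import Function using (_∘_)
  open import Relation.Binary.PropositionalEquality

  -- A matrix is a list I of row indices and a list of columns f, with entries f a (a ∈ I).
  Col : Set
  Col = ℕ → ℤ

  -- The minor M is kept as a function of the remaining columns (the columns
  -- already passed are prepended to its argument), so a column property of Det I that holds at every
  -- position passes to expand a k (Det I) by induction on the columns.
  expand : ℕ → ℕ → (List Col → ℤ) → List Col → ℤ
  expand a k M []       = 0ℤ
  expand a k M (f ∷ fs) = sign k * f a * M fs + expand a (suc k) (M ∘ (f ∷_)) fs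

  -- Non-square matrices get determinant 0, so that linearity and alternation hold without side conditions.
  Det : List ℕ → List Col → ℤ
  Det []      []      = 1ℤ
  Det []      (_ ∷ _) = 0ℤ
  Det (a ∷ I) cs      = expand a 0 (Det I) cs

  prodℤ : List ℤ → ℤ
  prodℤ = foldr _*_ 1ℤ

  sign-suc : ∀ k → sign (suc k) ≡ - sign k
  sign-suc zero          = refl
  sign-suc (suc zero)    = refl
  sign-suc (suc (suc k)) = sign-suc k

  *-+-interchange : ∀ x m n e₁ e₂ → x * (m + n) + (e₁ + e₂) ≡ (x * m + e₁) + (x * n + e₂)
  *-+-interchange = solve-∀

  expand-minors-zero : ∀ a k {M} → (∀ Z → M Z ≡ 0ℤ) → ∀ fs → expand a k M fs ≡ 0ℤ
  expand-minors-zero a k M≡0 []       = refl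
  expand-minors-zero a k M≡0 (f ∷ fs) =
    cong₂ _+_ (trans (cong (sign k * f a *_) (M≡0 fs)) (*-zeroʳ (sign k * f a)))
              (expand-minors-zero a (suc k) (M≡0 ∘ (f ∷_)) fs)

  expand-minors-+ : ∀ a k {L M N} → (∀ Z → L Z ≡ M Z + N Z) →
                    ∀ fs → expand a k L fs ≡ expand a k M fs + expand a k N fs
  expand-minors-+ a k L≡M+N []       = refl
  expand-minors-+ a k L≡M+N (f ∷ fs) =
    trans (cong₂ (λ l e → sign k * f a * l + e) (L≡M+N fs) (expand-minors-+ a (suc k) (L≡M+N ∘ (f ∷_)) fs))
          (*-+-interchange (sign k * f a) _ _ _ _)

  module _ {f g h : Col} (h≡f+g : ∀ a → h a ≡ f a + g a) where

    AdditiveAt : (List Col → ℤ) → Set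
    AdditiveAt D = ∀ X Y → D (X ++ h ∷ Y) ≡ D (X ++ f ∷ Y) + D (X ++ g ∷ Y)

    expand-additive : ∀ a k {D} → AdditiveAt D → ∀ P Q →
      expand a k D (P ++ h ∷ Q) ≡ expand a k D (P ++ f ∷ Q) + expand a k D (P ++ g ∷ Q)
    expand-additive a k {D} D-add [] Q =
      trans (cong₂ (λ x e → sign k * x * D Q + e) (h≡f+g a) (expand-minors-+ a (suc k) (D-add []) Q))
            (distrib (sign k) (f a) (g a) (D Q) _ _)
      where
      distrib : ∀ s x y d e₁ e₂ → s * (x + y) * d + (e₁ + e₂) ≡ (s * x * d + e₁) + (s * y * d + e₂)
      distrib = solve-∀
    expand-additive a k {D} D-add (p ∷ P) Q =
      trans (cong₂ (λ d e → sign k * p a * d + e) (D-add P Q) (expand-additive a (suc k) (D-add ∘ (p ∷_)) P Q))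
            (*-+-interchange (sign k * p a) _ _ _ _)

    Det-additive : ∀ I → AdditiveAt (Det I)
    Det-additive []      []      Y = refl
    Det-additive []      (_ ∷ _) Y = refl
    Det-additive (a ∷ I)         = expand-additive a 0 (Det-additive I)

  module _ (f : Col) where

    AlternatingAt : (List Col → ℤ) → Set
    AlternatingAt D = ∀ X Y → D (X ++ f ∷ f ∷ Y) ≡ 0ℤ

    expand-alternating : ∀ a k {D} → AlternatingAt D → ∀ P Q → expand a k D (P ++ f ∷ f ∷ Q) ≡ 0ℤ
    expand-alternating a k {D} D-alt [] Q =
      trans (cong₂ (λ s e → sign k * f a * D (f ∷ Q) + (s * f a * D (f ∷ Q) + e))
                   (sign-suc k) (expand-minors-zero a (suc (suc k)) (D-alt []) Q))
            (cancel (sign k) (f a) (D (f ∷ Q)))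
      where
      cancel : ∀ s x d → s * x * d + (- s * x * d + 0ℤ) ≡ 0ℤ
      cancel = solve-∀
    expand-alternating a k {D} D-alt (p ∷ P) Q =
      trans (cong₂ (λ d e → sign k * p a * d + e) (D-alt P Q) (expand-alternating a (suc k) (D-alt ∘ (p ∷_)) P Q))
            (vanish (sign k) (p a))
      where
      vanish : ∀ s x → s * x * 0ℤ + 0ℤ ≡ 0ℤ
      vanish = solve-∀

    Det-alternating : ∀ I → AlternatingAt (Det I)
    Det-alternating []      []      Y = refl
    Det-alternating []      (_ ∷ _) Y = refl
    Det-alternating (a ∷ I)         = expand-alternating a 0 (Det-alternating I)

  Det-add-left-neighbour : ∀ I P Q {f g h : Col} → (∀ a → h a ≡ g a + f a) →
                           Det I (P ++ f ∷ h ∷ Q) ≡ Det I (P ++ f ∷ g ∷ Q)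
  Det-add-left-neighbour I P Q {f} {g} {h} h≡g+f = begin
    Det I (P ++ f ∷ h ∷ Q)
      ≡⟨ cong (Det I) (List.++-assoc P (f ∷ []) (h ∷ Q)) ⟨
    Det I ((P ++ f ∷ []) ++ h ∷ Q)
      ≡⟨ Det-additive h≡g+f I (P ++ f ∷ []) Q ⟩
    Det I ((P ++ f ∷ []) ++ g ∷ Q) + Det I ((P ++ f ∷ []) ++ f ∷ Q)
      ≡⟨ cong₂ _+_ (cong (Det I) (List.++-assoc P (f ∷ []) (g ∷ Q)))
                   (trans (cong (Det I) (List.++-assoc P (f ∷ []) (f ∷ Q))) (Det-alternating f I P Q)) ⟩
    Det I (P ++ f ∷ g ∷ Q) + 0ℤ
      ≡⟨ +-identityʳ _ ⟩
    Det I (P ++ f ∷ g ∷ Q)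
      ∎
    where open ≡-Reasoning

  expand-reindex : ∀ (h : ℕ → ℕ) a k {M N} → (∀ Z → M Z ≡ N (map (_∘ h) Z)) →
                   ∀ fs → expand (h a) k M fs ≡ expand a k N (map (_∘ h) fs)
  expand-reindex h a k M≡N []       = refl
  expand-reindex h a k M≡N (f ∷ fs) =
    cong₂ (λ m e → sign k * f (h a) * m + e) (M≡N fs) (expand-reindex h a (suc k) (M≡N ∘ (f ∷_)) fs)

  Det-reindex-rows : ∀ (h : ℕ → ℕ) I cs → Det (map h I) cs ≡ Det I (map (_∘ h) cs)
  Det-reindex-rows h []      []      = refl
  Det-reindex-rows h []      (_ ∷ _) = refl
  Det-reindex-rows h (a ∷ I) cs      = expand-reindex h a 0 (Det-reindex-rows h I) cs

  module _ (F G : ℕ → Col) (κ ρ : ℕ → ℤ) where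

    Scalable : ℕ → Set
    Scalable c = ∀ a → κ c * F c a ≡ ρ a * G c a

    expand-scale : ∀ a k {M N} p q →
      (∀ Z → All Scalable Z → p * prodℤ (map κ Z) * M (map F Z) ≡ q * N (map G Z)) →
      ∀ J → All Scalable J → p * prodℤ (map κ J) * expand a k M (map F J) ≡ q * ρ a * expand a k N (map G J)
    expand-scale a k p q minors [] [] = trans (*-zeroʳ (p * 1ℤ)) (sym (*-zeroʳ (q * ρ a)))
    expand-scale a k {M} {N} p q minors (c ∷ J) (sc ∷ scs) = begin
      p * (κ c * ∏κ) * (sign k * F c a * M (map F J) + E M F)
        ≡⟨ regroup (sign k) (κ c) (F c a) p ∏κ (M (map F J)) (E M F) ⟩
      sign k * (κ c * F c a) * (p * ∏κ * M (map F J)) + p * κ c * ∏κ * E M F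
        ≡⟨ cong₂ (λ x m → sign k * x * m + p * κ c * ∏κ * E M F) (sc a) (minors J scs) ⟩
      sign k * (ρ a * G c a) * (q * N (map G J)) + p * κ c * ∏κ * E M F
        ≡⟨ cong (sign k * (ρ a * G c a) * (q * N (map G J)) +_)
                (expand-scale a (suc k) (p * κ c) q
                   (λ Z zs → trans (assoc p (κ c) _ _) (minors (c ∷ Z) (sc ∷ zs))) J scs) ⟩
      sign k * (ρ a * G c a) * (q * N (map G J)) + q * ρ a * E N G
        ≡⟨ factor (sign k) (ρ a) (G c a) q (N (map G J)) (E N G) ⟩
      q * ρ a * (sign k * G c a * N (map G J) + E N G)
        ∎
      where
      open ≡-Reasoning
      ∏κ : ℤ
      ∏κ = prodℤ (map κ J)
      E : (List Col → ℤ) → (ℕ → Col) → ℤ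
      E M H = expand a (suc k) (M ∘ (H c ∷_)) (map H J)
      regroup : ∀ σ κ x p π m e → p * (κ * π) * (σ * x * m + e) ≡ σ * (κ * x) * (p * π * m) + p * κ * π * e
      regroup = solve-∀
      assoc : ∀ p κ π m → p * κ * π * m ≡ p * (κ * π) * m
      assoc = solve-∀
      factor : ∀ σ t y q n e → σ * (t * y) * (q * n) + q * t * e ≡ q * t * (σ * y * n + e)
      factor = solve-∀

    Det-scale : ∀ I J → All Scalable J → prodℤ (map κ J) * Det I (map F J) ≡ prodℤ (map ρ I) * Det I (map G J)
    Det-scale []      []      []        = refl
    Det-scale []      (c ∷ J) _         = *-zeroʳ (prodℤ (map κ (c ∷ J)))
    Det-scale (a ∷ I) J       scalable  = begin
      prodℤ (map κ J) * expand a 0 (Det I) (map F J)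
        ≡⟨ cong (_* expand a 0 (Det I) (map F J)) (*-identityˡ (prodℤ (map κ J))) ⟨
      1ℤ * prodℤ (map κ J) * expand a 0 (Det I) (map F J)
        ≡⟨ expand-scale a 0 1ℤ (prodℤ (map ρ I)) minors J scalable ⟩
      prodℤ (map ρ I) * ρ a * expand a 0 (Det I) (map G J)
        ≡⟨ cong (_* expand a 0 (Det I) (map G J)) (*-comm (prodℤ (map ρ I)) (ρ a)) ⟩
      ρ a * prodℤ (map ρ I) * expand a 0 (Det I) (map G J)
        ∎
      where
      open ≡-Reasoning
      minors : ∀ Z → All Scalable Z →
               1ℤ * prodℤ (map κ Z) * Det I (map F Z) ≡ prodℤ (map ρ I) * Det I (map G Z)
      minors Z zs = trans (cong (_* Det I (map F Z)) (*-identityˡ (prodℤ (map κ Z)))) (Det-scale I Z zs)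

  expand-zero-row : ∀ a k M fs → All (λ f → f a ≡ 0ℤ) fs → expand a k M fs ≡ 0ℤ
  expand-zero-row a k M []       []            = refl
  expand-zero-row a k M (f ∷ fs) (fa≡0 ∷ fs≡0) =
    cong₂ _+_ (trans (cong (λ x → sign k * x * M fs) fa≡0)
                     (trans (cong (_* M fs) (*-zeroʳ (sign k))) (*-zeroˡ (M fs))))
              (expand-zero-row a (suc k) (M ∘ (f ∷_)) fs fs≡0)

  Det-zero-row : ∀ a I cs → All (λ f → f a ≡ 0ℤ) cs → Det (a ∷ I) cs ≡ 0ℤ
  Det-zero-row a I = expand-zero-row a 0 (Det I)

  Det-unit-row : ∀ a I f cs → f a ≡ 1ℤ → All (λ g → g a ≡ 0ℤ) cs → Det (a ∷ I) (f ∷ cs) ≡ Det I cs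
  Det-unit-row a I f cs fa≡1 cs≡0 =
    trans (cong₂ (λ x e → 1ℤ * x * Det I cs + e) fa≡1 (expand-zero-row a 1 (Det I ∘ (f ∷_)) cs cs≡0))
          (trans (+-identityʳ _) (*-identityˡ (Det I cs)))

  rowsOf : List ℕ → List Col → List (List ℤ)
  rowsOf I cs = map (λ a → map (λ f → f a) cs) I

  module _ (n : ℕ) (rows : List (List ℤ)) where

    laplace : ℕ → List ℤ → ℤ
    laplace k []       = 0ℤ
    laplace k (x ∷ xs) = sign k * x * detN n (map (dropAt k) rows) + laplace (suc k) xs

    laplace-unique : (go : List ℤ → ℕ → List ℤ → ℤ) → (∀ row k → go row k [] ≡ 0ℤ) →
      (∀ row k x xs → go row k (x ∷ xs) ≡ sign k * x * detN n (map (dropAt k) rows) + go row (suc k) xs) →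
      ∀ row k xs → go row k xs ≡ laplace k xs
    laplace-unique go nil cons row k []       = nil row k
    laplace-unique go nil cons row k (x ∷ xs) =
      trans (cons row k x xs)
            (cong (sign k * x * detN n (map (dropAt k) rows) +_) (laplace-unique go nil cons row (suc k) xs))

  -- The loop of detN is local to its defining clause.  It is captured by unifying the metavariable
  -- below with it, which is possible once its arguments have been abstracted into variables.
  detN-laplace : ∀ n rows row → detN (suc n) (row ∷ rows) ≡ laplace n rows 0 row
  detN-laplace n rows []       = refl
  detN-laplace n rows (x ∷ xs) with laplace-unique n rows _ (λ _ _ → refl) (λ _ _ _ _ → refl) | x ∷ xs | 1 | xs
  ... | loop | row | k | ys = cong (sign 0 * x * detN n (map (dropAt 0) rows) +_) (loop row k ys)

  dropAt-map : ∀ {A B : Set} (g : A → B) k xs → dropAt k (map g xs) ≡ map g (dropAt k xs)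
  dropAt-map g k       []       = refl
  dropAt-map g zero    (x ∷ xs) = refl
  dropAt-map g (suc k) (x ∷ xs) = cong (g x ∷_) (dropAt-map g k xs)

  dropAt-length : ∀ {A : Set} (P : List A) x Q → dropAt (length P) (P ++ x ∷ Q) ≡ P ++ Q
  dropAt-length []      x Q = refl
  dropAt-length (p ∷ P) x Q = cong (p ∷_) (dropAt-length P x Q)

  dropAt-rowsOf : ∀ I P f Q → map (dropAt (length P)) (rowsOf I (P ++ f ∷ Q)) ≡ rowsOf I (P ++ Q)
  dropAt-rowsOf []      P f Q = refl
  dropAt-rowsOf (a ∷ I) P f Q = cong₂ _∷_
    (trans (dropAt-map (λ g → g a) (length P) (P ++ f ∷ Q)) (cong (map (λ g → g a)) (dropAt-length P f Q)))
    (dropAt-rowsOf I P f Q)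

  laplace-rowsOf : ∀ a I → (∀ cs → length cs ≡ length I → detN (length I) (rowsOf I cs) ≡ Det I cs) →
    ∀ P Q {M} → (∀ Z → M Z ≡ Det I (P ++ Z)) → length (P ++ Q) ≡ suc (length I) →
    laplace (length I) (rowsOf I (P ++ Q)) (length P) (map (λ f → f a) Q) ≡ expand a (length P) M Q
  laplace-rowsOf a I detN≡Det P []          M≡ len = refl
  laplace-rowsOf a I detN≡Det P (f ∷ Q) {M} M≡ len = cong₂ (λ d e → sign (length P) * f a * d + e) minor rest
    where
    minor : detN (length I) (map (dropAt (length P)) (rowsOf I (P ++ f ∷ Q))) ≡ M Q
    minor = begin
      detN (length I) (map (dropAt (length P)) (rowsOf I (P ++ f ∷ Q)))
        ≡⟨ cong (detN (length I)) (dropAt-rowsOf I P f Q) ⟩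
      detN (length I) (rowsOf I (P ++ Q))
        ≡⟨ detN≡Det (P ++ Q) (ℕ.suc-injective (trans (sym (List.length-++-sucʳ P f Q)) len)) ⟩
      Det I (P ++ Q)
        ≡⟨ M≡ Q ⟨
      M Q
        ∎
      where open ≡-Reasoning
    move-f : ∀ Z → (P ++ f ∷ []) ++ Z ≡ P ++ f ∷ Z
    move-f = List.++-assoc P (f ∷ [])
    rest : laplace (length I) (rowsOf I (P ++ f ∷ Q)) (suc (length P)) (map (λ g → g a) Q)
         ≡ expand a (suc (length P)) (M ∘ (f ∷_)) Q
    rest = subst₂ (λ cs k → laplace (length I) (rowsOf I cs) k (map (λ g → g a) Q) ≡ expand a k (M ∘ (f ∷_)) Q)
                  (move-f Q) (trans (List.length-++-sucʳ P f []) (cong (suc ∘ length) (List.++-identityʳ P)))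
                  (laplace-rowsOf a I detN≡Det (P ++ f ∷ []) Q
                                  (λ Z → trans (M≡ (f ∷ Z)) (cong (Det I) (sym (move-f Z))))
                                  (trans (cong length (move-f Q)) len))

  detN-rowsOf : ∀ I cs → length cs ≡ length I → detN (length I) (rowsOf I cs) ≡ Det I cs
  detN-rowsOf []      []  _   = refl
  detN-rowsOf (a ∷ I) cs  len =
    trans (detN-laplace (length I) (rowsOf I cs) (map (λ f → f a) cs))
          (laplace-rowsOf a I (detN-rowsOf I) [] cs (λ _ → refl) len)

module Ranges where

  open import Data.List using (List; []; _∷_; _++_; map; length; upTo; applyUpTo)
  import Data.List.Properties as List
  open import Data.List.Relation.Unary.All as All using (All; []; _∷_)
  import Data.List.Relation.Unary.All.Properties as All
  open import Data.Nat using (ℕ; zero; suc; _+_; _∸_; _≤_; _<_; _≟_; s≤s)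
  import Data.Nat.Properties as ℕ
  open import Relation.Nullary using (¬?)
  open import Relation.Binary.PropositionalEquality

  range : ℕ → ℕ → List ℕ
  range k zero    = []
  range k (suc n) = k ∷ range (suc k) n

  length-range : ∀ k n → length (range k n) ≡ n
  length-range k zero    = refl
  length-range k (suc n) = cong suc (length-range (suc k) n)

  range-++ : ∀ k m n → range k (m + n) ≡ range k m ++ range (k + m) n
  range-++ k zero    n = cong (λ l → range l n) (sym (ℕ.+-identityʳ k))
  range-++ k (suc m) n =
    cong (k ∷_) (trans (range-++ (suc k) m n) (cong (λ l → range (suc k) m ++ range l n) (sym (ℕ.+-suc k m))))

  range-suc : ∀ k n → range k (suc n) ≡ range k n ++ (k + n) ∷ []
  range-suc k n = trans (cong (range k) (ℕ.+-comm 1 n)) (range-++ k n 1)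

  map-suc-range : ∀ k n → map suc (range k n) ≡ range (suc k) n
  map-suc-range k zero    = refl
  map-suc-range k (suc n) = cong (suc k ∷_) (map-suc-range (suc k) n)

  map-∸-range : ∀ j k n → j ≤ k → map (_∸ j) (range k n) ≡ range (k ∸ j) n
  map-∸-range j k zero    j≤k = refl
  map-∸-range j k (suc n) j≤k =
    cong ((k ∸ j) ∷_) (trans (map-∸-range j (suc k) n (ℕ.m≤n⇒m≤1+n j≤k))
                             (cong (λ l → range l n) (ℕ.+-∸-assoc 1 j≤k)))

  range-≥ : ∀ k n → All (k ≤_) (range k n)
  range-≥ k zero    = []
  range-≥ k (suc n) = ℕ.≤-refl ∷ All.map ℕ.<⇒≤ (range-≥ (suc k) n)

  range-< : ∀ k n → All (_< k + n) (range k n)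
  range-< k zero    = []
  range-< k (suc n) =
    subst (λ m → All (_< m) (range k (suc n))) (sym (ℕ.+-suc k n)) (s≤s (ℕ.m≤m+n k n) ∷ range-< (suc k) n)

  applyUpTo-range : ∀ (f : ℕ → ℕ) k n → (∀ x → f x ≡ k + x) → applyUpTo f n ≡ range k n
  applyUpTo-range f k zero    f≗k+ = refl
  applyUpTo-range f k (suc n) f≗k+ =
    cong₂ _∷_ (trans (f≗k+ 0) (ℕ.+-identityʳ k))
              (applyUpTo-range (λ x → f (suc x)) (suc k) n (λ x → trans (f≗k+ (suc x)) (ℕ.+-suc k x)))

  interval≡range : ∀ k n → [ k , k + n ] ≡ range k (suc n)
  interval≡range k n = begin
    map (k +_) (upTo (suc (k + n) ∸ k))
      ≡⟨ cong (λ m → map (k +_) (upTo (m ∸ k))) (ℕ.+-suc k n) ⟨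
    map (k +_) (upTo (k + suc n ∸ k))
      ≡⟨ cong (λ m → map (k +_) (upTo m)) (ℕ.m+n∸m≡n k (suc n)) ⟩
    map (k +_) (upTo (suc n))
      ≡⟨ List.map-applyUpTo (λ x → x) (k +_) (suc n) ⟩
    applyUpTo (k +_) (suc n)
      ≡⟨ applyUpTo-range (k +_) k (suc n) (λ _ → refl) ⟩
    range k (suc n)
      ∎
    where open ≡-Reasoning

  gapRange : ℕ → ℕ → ℕ → List ℕ
  gapRange k g t = range k g ++ range (suc (k + g)) t

  length-gapRange : ∀ k g t → length (gapRange k g t) ≡ g + t
  length-gapRange k g t =
    trans (List.length-++ (range k g)) (cong₂ _+_ (length-range k g) (length-range (suc (k + g)) t))

  gapRange-≥ : ∀ k g t → All (k ≤_) (gapRange k g t)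
  gapRange-≥ k g t =
    All.++⁺ (range-≥ k g) (All.map (ℕ.≤-trans (ℕ.m≤n⇒m≤1+n (ℕ.m≤m+n k g))) (range-≥ (suc (k + g)) t))

  map-∸-gapRange : ∀ j k g t → j ≤ k → map (_∸ j) (gapRange k g t) ≡ gapRange (k ∸ j) g t
  map-∸-gapRange j k g t j≤k = begin
    map (_∸ j) (range k g ++ range (suc (k + g)) t)
      ≡⟨ List.map-++ (_∸ j) (range k g) _ ⟩
    map (_∸ j) (range k g) ++ map (_∸ j) (range (suc (k + g)) t)
      ≡⟨ cong₂ _++_ (map-∸-range j k g j≤k) (map-∸-range j (suc (k + g)) t j≤1+k+g) ⟩
    range (k ∸ j) g ++ range (suc (k + g) ∸ j) t
      ≡⟨ cong (λ l → range (k ∸ j) g ++ range l t)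
              (trans (ℕ.+-∸-assoc 1 j≤k+g) (cong suc (ℕ.+-∸-comm g j≤k))) ⟩
    range (k ∸ j) g ++ range (suc (k ∸ j + g)) t
      ∎
    where
    open ≡-Reasoning
    j≤k+g : j ≤ k + g
    j≤k+g = ℕ.≤-trans j≤k (ℕ.m≤m+n k g)
    j≤1+k+g : j ≤ suc (k + g)
    j≤1+k+g = ℕ.m≤n⇒m≤1+n j≤k+g

  range-∖ : ∀ k p t {x} → x ≡ k + p → range k (p + suc t) ∖[ x ] ≡ range k p ++ range (suc x) t
  range-∖ k p t {x} refl = begin
    range k (p + suc t) ∖[ x ]
      ≡⟨ cong (_∖[ x ]) (range-++ k p (suc t)) ⟩
    (range k p ++ x ∷ range (suc x) t) ∖[ x ]
      ≡⟨ List.filter-++ (λ y → ¬? (y ≟ x)) (range k p) _ ⟩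
    range k p ∖[ x ] ++ (x ∷ range (suc x) t) ∖[ x ]
      ≡⟨ cong₂ _++_ (List.filter-all (λ y → ¬? (y ≟ x)) (All.map ℕ.<⇒≢ (range-< k p)))
                    (trans (List.filter-reject (λ y → ¬? (y ≟ x)) (λ x≢x → x≢x refl))
                           (List.filter-all (λ y → ¬? (y ≟ x)) (All.map ℕ.>⇒≢ (range-≥ (suc x) t)))) ⟩
    range k p ++ range (suc x) t
      ∎
    where open ≡-Reasoning

module Binomials where

  open import Data.Nat using (_*_; _∸_; _≤_; _!; NonZero; ≢-nonZero⁻¹)
  import Data.Nat.Properties as ℕ
  open import Data.Nat.Combinatorics using (_C_; nCk≡n!/k![n-k]!; k![n∸k]!∣n!; k>n⇒nCk≡0)
  open import Data.Nat.DivMod using (m/n*n≡m)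
  open import Data.Nat.Tactic.RingSolver using (solve-∀)
  open import Relation.Binary.PropositionalEquality
  open import Relation.Nullary using (yes; no)

  nCk*[k!*[n∸k]!]≡n! : ∀ {n k} → k ≤ n → (n C k) * (k ! * (n ∸ k) !) ≡ n !
  nCk*[k!*[n∸k]!]≡n! {n} {k} k≤n =
    trans (cong (_* (k ! * (n ∸ k) !)) (nCk≡n!/k![n-k]! k≤n)) (m/n*n≡m (k![n∸k]!∣n! k≤n))
    where
    instance
      nonZero : NonZero (k ! * (n ∸ k) !)
      nonZero = ℕ._!*_!≢0 k (n ∸ k)

  nCk≢0 : ∀ {n k} → k ≤ n → n C k ≢ 0
  nCk≢0 {n} {k} k≤n nCk≡0 = ≢-nonZero⁻¹ (n !) {{ℕ._!≢0 n}}
    (trans (sym (nCk*[k!*[n∸k]!]≡n! k≤n)) (cong (_* (k ! * (n ∸ k) !)) nCk≡0))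

  binomial-subset-≤ : ∀ a c j → j ≤ c → c ≤ a → (c C j) * (a C c) ≡ (a C j) * ((a ∸ j) C (c ∸ j))
  binomial-subset-≤ a c j j≤c c≤a =
    ℕ.*-cancelʳ-≡ _ _ (j ! * ((c ∸ j) ! * (a ∸ c) !)) {{nonZero}} (trans lhs (sym rhs))
    where
    open ≡-Reasoning
    nonZero : NonZero (j ! * ((c ∸ j) ! * (a ∸ c) !))
    nonZero = ℕ.m*n≢0 (j !) _ {{ℕ._!≢0 j}} {{ℕ._!*_!≢0 (c ∸ j) (a ∸ c)}}
    lhs : (c C j) * (a C c) * (j ! * ((c ∸ j) ! * (a ∸ c) !)) ≡ a !
    lhs = begin
      (c C j) * (a C c) * (j ! * ((c ∸ j) ! * (a ∸ c) !))
        ≡⟨ regroup (c C j) (a C c) (j !) ((c ∸ j) !) ((a ∸ c) !) ⟩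
      (a C c) * ((c C j) * (j ! * (c ∸ j) !) * (a ∸ c) !)
        ≡⟨ cong (λ x → (a C c) * (x * (a ∸ c) !)) (nCk*[k!*[n∸k]!]≡n! j≤c) ⟩
      (a C c) * (c ! * (a ∸ c) !)
        ≡⟨ nCk*[k!*[n∸k]!]≡n! c≤a ⟩
      a !
        ∎
      where
      regroup : ∀ x y p q r → x * y * (p * (q * r)) ≡ y * (x * (p * q) * r)
      regroup = solve-∀
    a∸j∸[c∸j]≡a∸c : (a ∸ j) ∸ (c ∸ j) ≡ a ∸ c
    a∸j∸[c∸j]≡a∸c = trans (ℕ.∸-+-assoc a j (c ∸ j)) (cong (a ∸_) (ℕ.m+[n∸m]≡n j≤c))
    rhs : (a C j) * ((a ∸ j) C (c ∸ j)) * (j ! * ((c ∸ j) ! * (a ∸ c) !)) ≡ a !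
    rhs = begin
      (a C j) * ((a ∸ j) C (c ∸ j)) * (j ! * ((c ∸ j) ! * (a ∸ c) !))
        ≡⟨ regroup (a C j) ((a ∸ j) C (c ∸ j)) (j !) ((c ∸ j) !) ((a ∸ c) !) ⟩
      (a C j) * (j ! * (((a ∸ j) C (c ∸ j)) * ((c ∸ j) ! * (a ∸ c) !)))
        ≡⟨ cong (λ x → (a C j) * (j ! * (((a ∸ j) C (c ∸ j)) * ((c ∸ j) ! * x !)))) a∸j∸[c∸j]≡a∸c ⟨
      (a C j) * (j ! * (((a ∸ j) C (c ∸ j)) * ((c ∸ j) ! * ((a ∸ j) ∸ (c ∸ j)) !)))
        ≡⟨ cong (λ x → (a C j) * (j ! * x)) (nCk*[k!*[n∸k]!]≡n! (ℕ.∸-monoˡ-≤ j c≤a)) ⟩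
      (a C j) * (j ! * (a ∸ j) !)
        ≡⟨ nCk*[k!*[n∸k]!]≡n! (ℕ.≤-trans j≤c c≤a) ⟩
      a !
        ∎
      where
      regroup : ∀ x y p q r → x * y * (p * (q * r)) ≡ x * (p * (y * (q * r)))
      regroup = solve-∀

  binomial-subset : ∀ a c j → j ≤ c → (c C j) * (a C c) ≡ (a C j) * ((a ∸ j) C (c ∸ j))
  binomial-subset a c j j≤c with c ℕ.≤? a | j ℕ.≤? a
  ... | yes c≤a | _       = binomial-subset-≤ a c j j≤c c≤a
  ... | no  c≰a | yes j≤a = begin
    (c C j) * (a C c)                   ≡⟨ cong ((c C j) *_) (k>n⇒nCk≡0 (ℕ.≰⇒> c≰a)) ⟩
    (c C j) * 0                         ≡⟨ ℕ.*-zeroʳ (c C j) ⟩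
    0                                   ≡⟨ ℕ.*-zeroʳ (a C j) ⟨
    (a C j) * 0                         ≡⟨ cong ((a C j) *_) (k>n⇒nCk≡0 (ℕ.∸-monoˡ-< (ℕ.≰⇒> c≰a) j≤a)) ⟨
    (a C j) * ((a ∸ j) C (c ∸ j))       ∎
    where open ≡-Reasoning
  ... | no  c≰a | no  j≰a = begin
    (c C j) * (a C c)                   ≡⟨ cong ((c C j) *_) (k>n⇒nCk≡0 (ℕ.≰⇒> c≰a)) ⟩
    (c C j) * 0                         ≡⟨ ℕ.*-zeroʳ (c C j) ⟩
    0                                   ≡⟨ cong (_* ((a ∸ j) C (c ∸ j))) (k>n⇒nCk≡0 (ℕ.≰⇒> j≰a)) ⟨
    (a C j) * ((a ∸ j) C (c ∸ j))       ∎
    where open ≡-Reasoning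

module BinomialDeterminants where

  open Determinants
  open Ranges
  open Binomials

  open import Data.Integer as ℤ using (ℤ; +_; 0ℤ)
  import Data.Integer.Properties as ℤ
  open import Data.List using (List; []; _∷_; _++_; map; length)
  import Data.List.Properties as List
  open import Data.List.Relation.Unary.All as All using (All; []; _∷_)
  import Data.List.Relation.Unary.All.Properties as All
  open import Data.Nat using (ℕ; zero; suc; _+_; _*_; _∸_; _≤_; _<_)
  import Data.Nat.Properties as ℕ
  open import Data.Nat.Combinatorics using (_C_; k>n⇒nCk≡0; nCn≡1; nCk+nC[k+1]≡[n+1]C[k+1])
  open import Data.Sum using (inj₁; inj₂)
  open import Function using (_∘_)
  open import Relation.Binary.PropositionalEquality

  col : ℕ → Col
  col e a = + (a C e)

  shiftedCol : ℕ → Col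
  shiftedCol e = col e ∘ suc

  bIJ≡Det : ∀ I J → length J ≡ length I → bIJ I J ≡ Det I (map col J)
  bIJ≡Det I J len = begin
    detN (length M) M
      ≡⟨ cong₂ detN (List.length-map _ I) (List.map-cong (λ a → List.map-∘ J) I) ⟩
    detN (length I) (rowsOf I (map col J))
      ≡⟨ detN-rowsOf I (map col J) (trans (List.length-map col J) len) ⟩
    Det I (map col J)
      ∎
    where
    open ≡-Reasoning
    M : List (List ℤ)
    M = map (λ a → map (λ c → + b a c) J) I

  pascal : ∀ e a → shiftedCol (suc e) a ≡ col (suc e) a ℤ.+ col e a
  pascal e a = cong +_ (sym (trans (ℕ.+-comm (a C suc e) (a C e)) (nCk+nC[k+1]≡[n+1]C[k+1] a e)))

  Det-shifted-run : ∀ R P e m Q → Det R (P ++ col e ∷ map shiftedCol (range (suc e) m) ++ Q)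
                                ≡ Det R (P ++ col e ∷ map col (range (suc e) m) ++ Q)
  Det-shifted-run R P e zero    Q = refl
  Det-shifted-run R P e (suc m) Q = begin
    Det R (P ++ col e ∷ shiftedCol (suc e) ∷ map shiftedCol (range (suc (suc e)) m) ++ Q)
      ≡⟨ Det-add-left-neighbour R P _ (pascal e) ⟩
    Det R (P ++ col e ∷ col (suc e) ∷ map shiftedCol (range (suc (suc e)) m) ++ Q)
      ≡⟨ cong (Det R) (List.++-assoc P (col e ∷ []) _) ⟨
    Det R ((P ++ col e ∷ []) ++ col (suc e) ∷ map shiftedCol (range (suc (suc e)) m) ++ Q)
      ≡⟨ Det-shifted-run R (P ++ col e ∷ []) (suc e) m Q ⟩
    Det R ((P ++ col e ∷ []) ++ col (suc e) ∷ map col (range (suc (suc e)) m) ++ Q)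
      ≡⟨ cong (Det R) (List.++-assoc P (col e ∷ []) _) ⟩
    Det R (P ++ col e ∷ col (suc e) ∷ map col (range (suc (suc e)) m) ++ Q)
      ∎
    where open ≡-Reasoning

  -- shiftedCol 0 and col 0 agree definitionally: both are constantly 1.
  Det-shifted-prefix : ∀ R n Q → Det R (map shiftedCol (range 0 n) ++ Q) ≡ Det R (map col (range 0 n) ++ Q)
  Det-shifted-prefix R zero    Q = refl
  Det-shifted-prefix R (suc n) Q = Det-shifted-run R [] 0 n Q

  col-vanishes-below : ∀ s L → All (s <_) L → All (λ f → f s ≡ 0ℤ) (map col L)
  col-vanishes-below s L s<L = All.map⁺ (All.map (λ s<c → cong +_ (k>n⇒nCk≡0 s<c)) s<L)

  -- The right-hand side is 1 for t = 0 and 0 otherwise.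
  Det-gap-base : ∀ k g t → Det (range k (g + t)) (map col (gapRange k g t)) ≡ + ((t ∸ 1) C t)
  Det-gap-base k zero    zero    = refl
  Det-gap-base k zero    (suc t) =
    trans (Det-zero-row k (range (suc k) t) _
            (col-vanishes-below k _ (All.map (ℕ.≤-<-trans (ℕ.m≤m+n k 0)) (range-≥ (suc (k + 0)) (suc t)))))
          (cong +_ (sym (k>n⇒nCk≡0 (ℕ.n<1+n t))))
  Det-gap-base k (suc g) t = begin
    Det (k ∷ range (suc k) (g + t)) (col k ∷ map col (range (suc k) g ++ range (suc (k + suc g)) t))
      ≡⟨ Det-unit-row k (range (suc k) (g + t)) (col k) _ (cong +_ (nCn≡1 k)) (col-vanishes-below k _ above-k) ⟩
    Det (range (suc k) (g + t)) (map col (range (suc k) g ++ range (suc (k + suc g)) t))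
      ≡⟨ cong (λ l → Det (range (suc k) (g + t)) (map col (range (suc k) g ++ range (suc l) t))) (ℕ.+-suc k g) ⟩
    Det (range (suc k) (g + t)) (map col (gapRange (suc k) g t))
      ≡⟨ Det-gap-base (suc k) g t ⟩
    + ((t ∸ 1) C t)
      ∎
    where
    open ≡-Reasoning
    above-k : All (k <_) (range (suc k) g ++ range (suc (k + suc g)) t)
    above-k =
      All.++⁺ (range-≥ (suc k) g) (All.map (ℕ.≤-<-trans (ℕ.m≤m+n k (suc g))) (range-≥ (suc (k + suc g)) t))

  mutual
    Det-gap : ∀ y g t → Det (range y (g + t)) (map col (gapRange 0 g t)) ≡ + ((y + t ∸ 1) C t)
    Det-gap zero    g t = Det-gap-base 0 g t
    Det-gap (suc y) g t = begin
      Det (range (suc y) (g + t)) (map col (gapRange 0 g t))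
        ≡⟨ cong (λ R → Det R (map col (gapRange 0 g t))) (map-suc-range y (g + t)) ⟨
      Det (map suc (range y (g + t))) (map col (gapRange 0 g t))
        ≡⟨ Det-reindex-rows suc (range y (g + t)) (map col (gapRange 0 g t)) ⟩
      Det (range y (g + t)) (map (_∘ suc) (map col (gapRange 0 g t)))
        ≡⟨ cong (Det (range y (g + t))) (trans (sym (List.map-∘ (gapRange 0 g t)))
                                               (List.map-++ shiftedCol (range 0 g) (range (suc g) t))) ⟩
      Det (range y (g + t)) (map shiftedCol (range 0 g) ++ map shiftedCol (range (suc g) t))
        ≡⟨ Det-shifted-prefix (range y (g + t)) g _ ⟩
      Det (range y (g + t)) (map col (range 0 g) ++ map shiftedCol (range (suc g) t))
        ≡⟨ Det-gap-shifted y g t ⟩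
      + ((y + t) C t)
        ∎
      where open ≡-Reasoning

    Det-gap-shifted : ∀ y g t → Det (range y (g + t)) (map col (range 0 g) ++ map shiftedCol (range (suc g) t))
                              ≡ + ((y + t) C t)
    Det-gap-shifted y g zero    =
      trans (cong (Det (range y (g + 0))) (sym (List.map-++ col (range 0 g) []))) (Det-gap y g zero)
    Det-gap-shifted y g (suc t) = begin
      Det R (Pre ++ shiftedCol (suc g) ∷ Rest)
        ≡⟨ Det-additive (pascal g) R Pre Rest ⟩
      Det R (Pre ++ col (suc g) ∷ Rest) ℤ.+ Det R (Pre ++ col g ∷ Rest)
        ≡⟨ cong₂ ℤ._+_ gap-kept gap-filled ⟩
      + ((y + suc t ∸ 1) C suc t) ℤ.+ + ((y + t) C t)
        ≡⟨ cong +_ binomial-step ⟩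
      + ((y + suc t) C suc t)
        ∎
      where
      open ≡-Reasoning
      R : List ℕ
      R = range y (g + suc t)
      Pre Rest : List Col
      Pre  = map col (range 0 g)
      Rest = map shiftedCol (range (suc (suc g)) t)
      gap-kept : Det R (Pre ++ col (suc g) ∷ Rest) ≡ + ((y + suc t ∸ 1) C suc t)
      gap-kept = begin
        Det R (Pre ++ col (suc g) ∷ Rest)
          ≡⟨ cong (λ Q → Det R (Pre ++ col (suc g) ∷ Q)) (List.++-identityʳ Rest) ⟨
        Det R (Pre ++ col (suc g) ∷ Rest ++ [])
          ≡⟨ Det-shifted-run R Pre (suc g) t [] ⟩
        Det R (Pre ++ col (suc g) ∷ map col (range (suc (suc g)) t) ++ [])
          ≡⟨ cong (λ Q → Det R (Pre ++ col (suc g) ∷ Q)) (List.++-identityʳ _) ⟩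
        Det R (Pre ++ map col (range (suc g) (suc t)))
          ≡⟨ cong (Det R) (List.map-++ col (range 0 g) _) ⟨
        Det R (map col (gapRange 0 g (suc t)))
          ≡⟨ Det-gap y g (suc t) ⟩
        + ((y + suc t ∸ 1) C suc t)
          ∎
      gap-filled : Det R (Pre ++ col g ∷ Rest) ≡ + ((y + t) C t)
      gap-filled = begin
        Det R (Pre ++ col g ∷ Rest)
          ≡⟨ cong (Det R) (List.++-assoc Pre (col g ∷ []) Rest) ⟨
        Det R ((Pre ++ col g ∷ []) ++ Rest)
          ≡⟨ cong (λ cs → Det R (cs ++ Rest)) (trans (sym (List.map-++ col (range 0 g) (g ∷ [])))
                                                      (cong (map col) (sym (range-suc 0 g)))) ⟩
        Det R (map col (range 0 (suc g)) ++ Rest)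
          ≡⟨ cong (λ n → Det (range y n) (map col (range 0 (suc g)) ++ Rest)) (ℕ.+-suc g t) ⟩
        Det (range y (suc g + t)) (map col (range 0 (suc g)) ++ Rest)
          ≡⟨ Det-gap-shifted y (suc g) t ⟩
        + ((y + t) C t)
          ∎
      binomial-step : (y + suc t ∸ 1) C suc t + (y + t) C t ≡ (y + suc t) C suc t
      binomial-step rewrite ℕ.+-suc y t =
        trans (ℕ.+-comm ((y + t) C suc t) ((y + t) C t)) (nCk+nC[k+1]≡[n+1]C[k+1] (y + t) t)

  binomial-factorization : ∀ j I J → All (j ≤_) J →
    prodℤ (map (λ c → + (c C j)) J) ℤ.* Det I (map col J)
      ≡ prodℤ (map (λ a → + (a C j)) I) ℤ.* Det (map (_∸ j) I) (map col (map (_∸ j) J))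
  binomial-factorization j I J j≤J = begin
    prodℤ (map (λ c → + (c C j)) J) ℤ.* Det I (map col J)
      ≡⟨ Det-scale col G (λ c → + (c C j)) (λ a → + (a C j)) I J (All.map scalable j≤J) ⟩
    prodℤ (map (λ a → + (a C j)) I) ℤ.* Det I (map G J)
      ≡⟨ cong (prodℤ (map (λ a → + (a C j)) I) ℤ.*_) reindex ⟨
    prodℤ (map (λ a → + (a C j)) I) ℤ.* Det (map (_∸ j) I) (map col (map (_∸ j) J))
      ∎
    where
    open ≡-Reasoning
    G : ℕ → Col
    G c = col (c ∸ j) ∘ (_∸ j)
    scalable : ∀ {c} → j ≤ c → ∀ a → + (c C j) ℤ.* col c a ≡ + (a C j) ℤ.* G c a
    scalable {c} j≤c a = begin
      + (c C j) ℤ.* + (a C c)               ≡⟨ ℤ.pos-* (c C j) (a C c) ⟨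
      + ((c C j) * (a C c))                 ≡⟨ cong +_ (binomial-subset a c j j≤c) ⟩
      + ((a C j) * ((a ∸ j) C (c ∸ j)))     ≡⟨ ℤ.pos-* (a C j) ((a ∸ j) C (c ∸ j)) ⟩
      + (a C j) ℤ.* G c a                   ∎
    reindex : Det (map (_∸ j) I) (map col (map (_∸ j) J)) ≡ Det I (map G J)
    reindex = trans (Det-reindex-rows (_∸ j) I (map col (map (_∸ j) J)))
                    (cong (Det I) (trans (sym (List.map-∘ (map (_∸ j) J))) (sym (List.map-∘ J))))

  prod-binomials-≢0 : ∀ {j J} → All (j ≤_) J → prodℤ (map (λ c → + (c C j)) J) ≢ 0ℤ
  prod-binomials-≢0 []          ()
  prod-binomials-≢0 (j≤c ∷ j≤J) prod≡0 with ℤ.i*j≡0⇒i≡0∨j≡0 _ prod≡0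
  ... | inj₁ binomial≡0 = nCk≢0 j≤c (ℤ.+-injective binomial≡0)
  ... | inj₂ rest≡0     = prod-binomials-≢0 j≤J rest≡0

module Rationals where

  open Determinants using (prodℤ)

  open import Data.Empty using (⊥-elim)
  open import Data.Integer as ℤ using (ℤ; 0ℤ)
  open import Data.List using ([]; _∷_; map)
  open import Data.Rational using (0ℚ; 1ℚ; _*_; 1/_; ↥_; NonZero; ≢-nonZero)
  open import Data.Rational.Literals using (fromℤ)
  import Data.Rational.Properties as ℚ
  import Data.Rational.Unnormalised.Properties as ℚᵘ
  open import Function using (_∘_)
  open import Relation.Binary.PropositionalEquality
  open import Relation.Nullary using (yes; no)

  ℤtoℚ≡fromℤ : ∀ z → ℤtoℚ z ≡ fromℤ z
  ℤtoℚ≡fromℤ z = ℚ.↥p/↧p≡p (fromℤ z)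

  ℤtoℚ-* : ∀ x y → ℤtoℚ (x ℤ.* y) ≡ ℤtoℚ x * ℤtoℚ y
  ℤtoℚ-* x y = begin
    ℤtoℚ (x ℤ.* y)      ≡⟨ ℤtoℚ≡fromℤ (x ℤ.* y) ⟩
    fromℤ (x ℤ.* y)     ≡⟨ ℚ.toℚᵘ-injective (ℚᵘ.≃-sym (ℚ.toℚᵘ-homo-* (fromℤ x) (fromℤ y))) ⟩
    fromℤ x * fromℤ y   ≡⟨ cong₂ _*_ (ℤtoℚ≡fromℤ x) (ℤtoℚ≡fromℤ y) ⟨
    ℤtoℚ x * ℤtoℚ y     ∎
    where open ≡-Reasoning

  ℤtoℚ-≢0 : ∀ {z} → z ≢ 0ℤ → ℤtoℚ z ≢ 0ℚ
  ℤtoℚ-≢0 {z} z≢0 z≡0 = z≢0 (cong ↥_ (trans (sym (ℤtoℚ≡fromℤ z)) z≡0))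

  prodℚ-ℤtoℚ : ∀ {A : Set} (f : A → ℤ) xs → prodℚ (map (ℤtoℚ ∘ f) xs) ≡ ℤtoℚ (prodℤ (map f xs))
  prodℚ-ℤtoℚ f []       = refl
  prodℚ-ℤtoℚ f (x ∷ xs) =
    trans (cong (ℤtoℚ (f x) *_) (prodℚ-ℤtoℚ f xs)) (sym (ℤtoℚ-* (f x) (prodℤ (map f xs))))

  ÷₀-solve : ∀ {b d n x} → d ≢ 0ℚ → d * b ≡ n * x → b ≡ (n ÷₀ d) * x
  ÷₀-solve {b} {d} {n} {x} d≢0 db≡nx with d ℚ.≟ 0ℚ
  ... | yes d≡0 = ⊥-elim (d≢0 d≡0)
  ... | no  _   = begin
    b                   ≡⟨ ℚ.*-identityˡ b ⟨
    1ℚ * b              ≡⟨ cong (_* b) (ℚ.*-inverseˡ d) ⟨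
    1/ d * d * b        ≡⟨ ℚ.*-assoc (1/ d) d b ⟩
    1/ d * (d * b)      ≡⟨ cong (1/ d *_) db≡nx ⟩
    1/ d * (n * x)      ≡⟨ ℚ.*-assoc (1/ d) n x ⟨
    1/ d * n * x        ≡⟨ cong (_* x) (ℚ.*-comm (1/ d) n) ⟩
    n * 1/ d * x        ∎
    where
    open ≡-Reasoning
    instance
      d-nonZero : NonZero d
      d-nonZero = ≢-nonZero d≢0

open Determinants using (Det; prodℤ)
open Ranges
open BinomialDeterminants
open Rationals

import Data.Integer as ℤ
open import Data.List using (List; _∷_; _++_; map; length)
import Data.List.Properties as List
open import Data.List.Relation.Unary.All using (All)
open import Data.Nat using (ℕ; zero; suc; _+_; _∸_; _≤_; _<_; s≤s)
import Data.Nat.Properties as ℕ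
open import Data.Nat.Combinatorics using (_C_)
open import Data.Product using (_×_; _,_)
open import Data.Sum using (_⊎_)
open import Data.Rational using (ℚ; 1ℚ; _*_)
import Data.Rational.Properties as ℚ
open import Function using (_∘_)
open import Relation.Binary.PropositionalEquality
  using (_≡_; refl; sym; trans; cong; cong₂; subst₂; module ≡-Reasoning)

bIJ≡πIJ*Det : ∀ I j J → length (j ∷ J) ≡ length I → All (j ≤_) (j ∷ J) →
  ℤtoℚ (bIJ I (j ∷ J)) ≡ πIJ I (j ∷ J) * ℤtoℚ (Det (map (_∸ j) I) (map col (map (_∸ j) (j ∷ J))))
bIJ≡πIJ*Det I j J len j≤J = begin
  ℤtoℚ (bIJ I (j ∷ J))
    ≡⟨ ÷₀-solve (ℤtoℚ-≢0 (prod-binomials-≢0 j≤J)) scaled ⟩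
  (ℤtoℚ N ÷₀ ℤtoℚ D) * ℤtoℚ X
    ≡⟨ cong (_* ℤtoℚ X) (cong₂ _÷₀_ (prodℚ-ℤtoℚ (λ a → ℤ.+ (a C j)) I)
                                     (prodℚ-ℤtoℚ (λ c → ℤ.+ (c C j)) (j ∷ J))) ⟨
  πIJ I (j ∷ J) * ℤtoℚ X
    ∎
  where
  open ≡-Reasoning
  D N X : ℤ.ℤ
  D = prodℤ (map (λ c → ℤ.+ (c C j)) (j ∷ J))
  N = prodℤ (map (λ a → ℤ.+ (a C j)) I)
  X = Det (map (_∸ j) I) (map col (map (_∸ j) (j ∷ J)))
  scaled : ℤtoℚ D * ℤtoℚ (bIJ I (j ∷ J)) ≡ ℤtoℚ N * ℤtoℚ X
  scaled = begin
    ℤtoℚ D * ℤtoℚ (bIJ I (j ∷ J))            ≡⟨ ℤtoℚ-* D _ ⟨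
    ℤtoℚ (D ℤ.* bIJ I (j ∷ J))               ≡⟨ cong (λ z → ℤtoℚ (D ℤ.* z)) (bIJ≡Det I (j ∷ J) len) ⟩
    ℤtoℚ (D ℤ.* Det I (map col (j ∷ J)))     ≡⟨ cong ℤtoℚ (binomial-factorization j I (j ∷ J) j≤J) ⟩
    ℤtoℚ (N ℤ.* X)                           ≡⟨ ℤtoℚ-* N X ⟩
    ℤtoℚ N * ℤtoℚ X                          ∎

bIJ-gap : ∀ i j g t → j ≤ i →
  ℤtoℚ (bIJ (range i (suc g + t)) (gapRange j (suc g) t))
    ≡ πIJ (range i (suc g + t)) (gapRange j (suc g) t) * toℚ ((i ∸ j + t ∸ 1) C t)
bIJ-gap i j g t j≤i = begin
  ℤtoℚ (bIJ I J)
    ≡⟨ bIJ≡πIJ*Det I j _ (trans (length-gapRange j (suc g) t) (sym (length-range i (suc g + t))))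
                         (gapRange-≥ j (suc g) t) ⟩
  πIJ I J * ℤtoℚ (Det (map (_∸ j) I) (map col (map (_∸ j) J)))
    ≡⟨ cong (λ X → πIJ I J * ℤtoℚ X)
            (cong₂ Det (map-∸-range j i (suc g + t) j≤i) (cong (map col) shifted-columns)) ⟩
  πIJ I J * ℤtoℚ (Det (range (i ∸ j) (suc g + t)) (map col (gapRange 0 (suc g) t)))
    ≡⟨ cong (λ X → πIJ I J * ℤtoℚ X) (Det-gap (i ∸ j) (suc g) t) ⟩
  πIJ I J * toℚ ((i ∸ j + t ∸ 1) C t)
    ∎
  where
  open ≡-Reasoning
  I J : List ℕ
  I = range i (suc g + t)
  J = gapRange j (suc g) t
  shifted-columns : map (_∸ j) J ≡ gapRange 0 (suc g) t
  shifted-columns =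
    trans (map-∸-gapRange j j (suc g) t ℕ.≤-refl) (cong (λ k → gapRange k (suc g) t) (ℕ.n∸n≡0 j))

bIJ-consecutive : ∀ i j n → j ≤ i →
  ℤtoℚ (bIJ (range i (suc n)) (range j (suc n))) ≡ πIJ (range i (suc n)) (range j (suc n))
bIJ-consecutive i j n j≤i =
  trans (subst₂ (λ I J → ℤtoℚ (bIJ I J) ≡ πIJ I J * 1ℚ)
                (cong (range i) (ℕ.+-identityʳ (suc n))) (List.++-identityʳ (range j (suc n)))
                (bIJ-gap i j n 0 j≤i))
        (ℚ.*-identityʳ _)

interval-rows : ∀ i m → [ i , i + suc (suc m) ∸ 2 ] ≡ range i (suc m)
interval-rows i m =
  trans (cong (λ l → [ i , l ∸ 2 ]) (trans (ℕ.+-suc i (suc m)) (cong suc (ℕ.+-suc i m)))) (interval≡range i m)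

interval-without : ∀ j m p t {x} → p + suc t ≡ suc (suc m) → x ≡ j + p →
                   [ j , j + suc (suc m) ∸ 1 ] ∖[ x ] ≡ range j p ++ range (suc x) t
interval-without j m p t {x} p+1+t≡2+m x≡j+p = begin
  [ j , j + suc (suc m) ∸ 1 ] ∖[ x ]  ≡⟨ cong (λ l → [ j , l ∸ 1 ] ∖[ x ]) (ℕ.+-suc j (suc m)) ⟩
  [ j , j + suc m ] ∖[ x ]            ≡⟨ cong (_∖[ x ]) (interval≡range j (suc m)) ⟩
  range j (suc (suc m)) ∖[ x ]        ≡⟨ cong (λ n → range j n ∖[ x ]) p+1+t≡2+m ⟨
  range j (p + suc t) ∖[ x ]          ≡⟨ range-∖ j p t x≡j+p ⟩
  range j p ++ range (suc x) t        ∎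
  where open ≡-Reasoning

inner-column-removed : ∀ m i j p → j ≤ i → p < m →
  ℤtoℚ (bIJ [ i , i + suc (suc m) ∸ 2 ] ([ j , j + suc (suc m) ∸ 1 ] ∖[ j + suc (suc p) ∸ 1 ]))
    ≡ πIJ [ i , i + suc (suc m) ∸ 2 ] ([ j , j + suc (suc m) ∸ 1 ] ∖[ j + suc (suc p) ∸ 1 ])
      * toℚ (b (i + suc (suc m) ∸ j ∸ suc (suc p) ∸ 1) (m ∸ p))
inner-column-removed m i j p j≤i p<m =
  transport (trans (cong (range i ∘ suc) p+t≡m) (sym (interval-rows i m))) (sym columns)
            (cong (λ n → toℚ (n C t)) exponent) (bIJ-gap i j p t j≤i)
  where
  t : ℕ
  t = m ∸ p
  p+t≡m : p + t ≡ m
  p+t≡m = ℕ.m+[n∸m]≡n (ℕ.<⇒≤ p<m)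
  x≡j+1+p : j + suc (suc p) ∸ 1 ≡ j + suc p
  x≡j+1+p = cong (_∸ 1) (ℕ.+-suc j (suc p))
  columns : [ j , j + suc (suc m) ∸ 1 ] ∖[ j + suc (suc p) ∸ 1 ] ≡ gapRange j (suc p) t
  columns = trans (interval-without j m (suc p) t (cong suc (trans (ℕ.+-suc p t) (cong suc p+t≡m))) x≡j+1+p)
                  (cong (λ x → range j (suc p) ++ range (suc x) t) x≡j+1+p)
  exponent : i ∸ j + t ∸ 1 ≡ i + suc (suc m) ∸ j ∸ suc (suc p) ∸ 1
  exponent = cong (_∸ 1) (sym (trans (cong (_∸ suc (suc p)) (ℕ.+-∸-comm (suc (suc m)) j≤i))
                                     (ℕ.+-∸-assoc (i ∸ j) (s≤s (s≤s (ℕ.<⇒≤ p<m))))))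
  transport : ∀ {I I′ J J′} {x x′ : ℚ} → I ≡ I′ → J ≡ J′ → x ≡ x′ →
              ℤtoℚ (bIJ I J) ≡ πIJ I J * x → ℤtoℚ (bIJ I′ J′) ≡ πIJ I′ J′ * x′
  transport refl refl refl holds = holds

theorem5p2 : (d i j : ℕ) → 2 ≤ d → j < i →
    ((r : ℕ) → 2 ≤ r → r ≤ d ∸ 1 →
      ℤtoℚ (bIJ [ i , i + d ∸ 2 ] ([ j , j + d ∸ 1 ] ∖[ j + r ∸ 1 ]))
        ≡ πIJ [ i , i + d ∸ 2 ] ([ j , j + d ∸ 1 ] ∖[ j + r ∸ 1 ])
          * toℚ (b (i + d ∸ j ∸ r ∸ 1) (d ∸ r)))
    × ((r : ℕ) → (r ≡ 1 ⊎ r ≡ d) →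
      (ℤtoℚ (bIJ [ i , i + d ∸ 2 ] ([ j , j + d ∸ 1 ] ∖[ j ]))
         ≡ πIJ [ i , i + d ∸ 2 ] ([ j , j + d ∸ 1 ] ∖[ j ]))
      × (ℤtoℚ (bIJ [ i , i + d ∸ 2 ] ([ j , j + d ∸ 1 ] ∖[ j + d ∸ 1 ]))
         ≡ πIJ [ i , i + d ∸ 2 ] ([ j , j + d ∸ 1 ] ∖[ j + d ∸ 1 ])))
theorem5p2 (suc (suc m)) i j (s≤s (s≤s _)) j<i =
    (λ { (suc (suc p)) _ (s≤s p<m) → inner-column-removed m i j p j≤i p<m ; (suc zero) (s≤s ()) _ })
  , λ _ _ → subst₂ b≡π (sym (interval-rows i m)) (sym first-removed) (bIJ-consecutive i (suc j) m j<i)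
          , subst₂ b≡π (sym (interval-rows i m)) (sym last-removed) (bIJ-consecutive i j m j≤i)
  where
  j≤i : j ≤ i
  j≤i = ℕ.<⇒≤ j<i
  b≡π : List ℕ → List ℕ → Set
  b≡π I J = ℤtoℚ (bIJ I J) ≡ πIJ I J
  first-removed : [ j , j + suc (suc m) ∸ 1 ] ∖[ j ] ≡ range (suc j) (suc m)
  first-removed = interval-without j m 0 (suc m) refl (sym (ℕ.+-identityʳ j))
  last-removed : [ j , j + suc (suc m) ∸ 1 ] ∖[ j + suc (suc m) ∸ 1 ] ≡ range j (suc m)
  last-removed = trans (interval-without j m (suc m) 0 (ℕ.+-comm (suc m) 1) (cong (_∸ 1) (ℕ.+-suc j (suc m))))
                       (List.++-identityʳ (range j (suc m)))
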